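{- Let $y\in\{0,1\}^\omega$ be a Sturmian word, let $f$ be any finite non-empty composition of morphisms from $\{L_0,L_1,R_0,R_1\}$, and set $x=f(y)$. If $x$ is singular, then $y$ is singular. Conversely, if $y=u'S'$ where $S'$ is a standard Sturmian word and $u'\in\{0,1\}^+$ with $|u'|\ge2$, then $x$ is singular; more precisely, there exist a standard Sturmian word $S$ and $u\in\{0,1\}^+$ with $|u'|\le|u|$ such that $x=uS$. Moreover, if $f$ has at least one occurrence of $L_0$ or $L_1$, then $|u'|<|u|$.
   Context: A word $x\in\{0,1\}^\omega$ is Sturmian if it is aperiodic (not ultimately periodic) and balanced: for all factors $u,v$ with $|u|=|v|$, $||u|_c-|v|_c|\le1$ for $c\in\{0,1\}$. A factor $u$ is left special if $0u$ and $1u$ are both factors. A Sturmian word is standard if all its prefixes are left special factors. A Sturmian word $x$ is singular if $x=uS$ for some $u\in\{0,1\}^+$ and some standard Sturmian word $S$. For $a\in\{0,1\}$ and $b=1-a$, $L_a$ and $R_a$ are the endomorphisms of $\{0,1\}^*$ (extended to infinite words) given by $L_a: a\mapsto a,\ b\mapsto ab$ and $R_a: a\mapsto a,\ b\mapsto ba$. -}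

module Defs where

open import Data.Bool using (Bool; true; false)
open import Data.Nat using (ℕ; zero; suc; _+_; _∸_; _≤_; _<_)
open import Data.List using (List; []; _∷_; _++_; length; foldr; concatMap; filter)
open import Data.List.NonEmpty using (List⁺; toList)
open import Data.List.Relation.Unary.Any using (Any)
open import Data.Product using (Σ; _×_; ∃)
open import Relation.Binary.PropositionalEquality using (_≡_)
open import Relation.Nullary using (¬_)
open import Data.Unit using (⊤)
open import Data.Empty using (⊥)

-- Letters: false = 0, true = 1.
-- Infinite words over {0,1}.
Word : Set
Word = ℕ → Bool

prefix : ℕ → Word → List Bool
prefix zero    x = []
prefix (suc n) x = x 0 ∷ prefix n (λ k → x (suc k))

shift : ℕ → Word → Word
shift i x k = x (i + k)

Factor : List Bool → Word → Set
Factor u x = ∃ λ i → prefix (length u) (shift i x) ≡ u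

count : Bool → List Bool → ℕ
count false []           = 0
count false (false ∷ u)  = suc (count false u)
count false (true ∷ u)   = count false u
count true  []           = 0
count true  (true ∷ u)   = suc (count true u)
count true  (false ∷ u)  = count true u

Dist≤1 : ℕ → ℕ → Set
Dist≤1 m n = (m ∸ n ≤ 1) × (n ∸ m ≤ 1)

Balanced : Word → Set
Balanced x = ∀ u v → Factor u x → Factor v x → length u ≡ length v →
  ∀ c → Dist≤1 (count c u) (count c v)

UltimatelyPeriodic : Word → Set
UltimatelyPeriodic x = ∃ λ p → (0 < p) × ∃ λ N → ∀ n → N ≤ n → x (n + p) ≡ x n

Aperiodic : Word → Set
Aperiodic x = ¬ UltimatelyPeriodic x

Sturmian : Word → Set
Sturmian x = Aperiodic x × Balanced x

LeftSpecial : List Bool → Word → Set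
LeftSpecial u x = Factor (false ∷ u) x × Factor (true ∷ u) x

StandardSturmian : Word → Set
StandardSturmian x = Sturmian x × (∀ n → LeftSpecial (prefix n x) x)

_++ω_ : List Bool → Word → Word
([] ++ω x) n = x n
((a ∷ u) ++ω x) zero = a
((a ∷ u) ++ω x) (suc n) = (u ++ω x) n

_≋_ : Word → Word → Set
x ≋ y = ∀ n → x n ≡ y n

Singular : Word → Set
Singular x = ∃ λ u → ∃ λ S → (1 ≤ length u) × StandardSturmian S × (x ≋ (u ++ω S))

data Gen : Set where
  L0 L1 R0 R1 : Gen

img : Gen → Bool → List Bool
img L0 false = false ∷ []
img L0 true  = false ∷ true ∷ []
img L1 true  = true ∷ []
img L1 false = true ∷ false ∷ []
img R0 false = false ∷ []
img R0 true  = true ∷ false ∷ []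
img R1 true  = true ∷ []
img R1 false = false ∷ true ∷ []

applyGen : Gen → List Bool → List Bool
applyGen g = concatMap (img g)

-- the list g₁ ∷ g₂ ∷ … ∷ gₖ denotes the composition g₁ ∘ g₂ ∘ … ∘ gₖ
applyFin : List Gen → List Bool → List Bool
applyFin gs w = foldr applyGen w gs

-- n-th letter of a finite word (default false if out of range)
at : List Bool → ℕ → Bool
at []      _       = false
at (a ∷ u) zero    = a
at (a ∷ u) (suc n) = at u n

-- Image of an infinite word under a composition of non-erasing morphisms:
-- the n-th letter of f(y) is the n-th letter of f(y[0..n]), which has length ≥ n+1
-- (all morphisms are non-erasing, so the default of 'at' is never used).
applyω : List Gen → Word → Word
applyω gs y n = at (applyFin gs (prefix (suc n) y)) n

IsL : Gen → Set
IsL L0 = ⊤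
IsL L1 = ⊤
IsL R0 = ⊥
IsL R1 = ⊥

-- Let b = 1 − a. In L_a(z) every b is preceded and followed by a, and the occurrences of a are exactly
-- the starts of the blocks L_a(z_k); hence a factor of L_a(z) lying between two occurrences of a is the
-- image of a factor of z. This desubstitution shows that L_a preserves balance and aperiodicity, and
-- that left special prefixes of L_a(z) come from left special prefixes of z, so a singular image has a
-- singular preimage; directly, L_a maps standard words to standard words. If z = u′S′ with |u′| ≥ 2 then
-- u′ contains both letters (a doubled letter before a standard word would violate balance), so
-- L_a(z) = L_a(u′) L_a(S′) with |L_a(u′)| > |u′|. Finally a R_a(w) = L_a(w) a, so R_a(z) is L_a(z) without
-- its first letter, which costs exactly the one letter gained.

module Submission where

open import Defs
open import Data.Bool using (Bool; true; false; not)
open import Data.Bool.Properties using (not-involutive; not-¬)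
open import Data.Empty using (⊥; ⊥-elim)
open import Data.List using (List; []; _∷_; _++_; _∷ʳ_; length; concatMap)
open import Data.List.NonEmpty using (List⁺; toList)
open import Data.List.Properties using (length-++; ++-cancelˡ; ++-identityʳ; ∷-injective; ∷-injectiveʳ; ∷ʳ-injective; ∷ʳ-++; concatMap-++)
open import Data.List.Relation.Unary.Any using (Any; toSum)
open import Data.Nat using (ℕ; zero; suc; _+_; _∸_; _≤_; _<_; z≤n; s≤s; s≤s⁻¹)
open import Data.Nat.Properties
open import Data.Product using (∃; _×_; _,_; proj₁; proj₂)
open import Data.Sum using (_⊎_; inj₁; inj₂)
open import Function using (_∘_)
open import Relation.Binary.PropositionalEquality
open import Relation.Nullary using (yes; no)

data Letter (a : Bool) : Bool → Set where
  is-a : Letter a a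
  is-b : Letter a (not a)

letter : ∀ a c → Letter a c
letter false false = is-a
letter false true  = is-b
letter true  true  = is-a
letter true  false = is-b

≋-sym : ∀ {x y} → x ≋ y → y ≋ x
≋-sym e n = sym (e n)

≋-trans : ∀ {x y z} → x ≋ y → y ≋ z → x ≋ z
≋-trans e f n = trans (e n) (f n)

slice : Word → ℕ → ℕ → List Bool
slice x i n = prefix n (shift i x)

prefix-cong : ∀ {x y} n → x ≋ y → prefix n x ≡ prefix n y
prefix-cong zero    e = refl
prefix-cong (suc n) e = cong₂ _∷_ (e 0) (prefix-cong n (λ k → e (suc k)))

length-prefix : ∀ n x → length (prefix n x) ≡ n
length-prefix zero    x = refl
length-prefix (suc n) x = cong suc (length-prefix n (shift 1 x))

length-slice : ∀ x i n → length (slice x i n) ≡ n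
length-slice x i n = length-prefix n (shift i x)

at-prefix : ∀ {n} x {i} → i < n → at (prefix n x) i ≡ x i
at-prefix {suc n} x {zero}  _        = refl
at-prefix {suc n} x {suc i} (s≤s lt) = at-prefix (shift 1 x) lt

at-slice : ∀ x p {n i} → i < n → at (slice x p n) i ≡ x (p + i)
at-slice x p lt = at-prefix (shift p x) lt

prefix-unique : ∀ (w : List Bool) x → (∀ {i} → i < length w → at w i ≡ x i) → prefix (length w) x ≡ w
prefix-unique []      x h = refl
prefix-unique (c ∷ w) x h = cong₂ _∷_ (sym (h (s≤s z≤n))) (prefix-unique w (shift 1 x) (λ lt → h (s≤s lt)))

prefix-+ : ∀ m n x → prefix (m + n) x ≡ prefix m x ++ slice x m n
prefix-+ zero    n x = refl
prefix-+ (suc m) n x = cong (x 0 ∷_) (prefix-+ m n (shift 1 x))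

slice-shift : ∀ k i n x → slice (shift k x) i n ≡ slice x (k + i) n
slice-shift k i n x = prefix-cong n (λ m → cong x (sym (+-assoc k i m)))

slice-+ : ∀ x i m n → slice x i (m + n) ≡ slice x i m ++ slice x (i + m) n
slice-+ x i m n = trans (prefix-+ m n (shift i x)) (cong (slice x i m ++_) (slice-shift i m n x))

slice-suc : ∀ x i n → slice x i (suc n) ≡ x i ∷ slice x (suc i) n
slice-suc x i n = cong₂ _∷_ (cong x (+-identityʳ i)) (prefix-cong n (λ k → cong x (+-suc i k)))

slice-∷ʳ : ∀ x i n → slice x i (suc n) ≡ slice x i n ∷ʳ x (i + n)
slice-∷ʳ x i n = begin
  slice x i (suc n)                    ≡⟨ cong (slice x i) (+-comm 1 n) ⟩
  slice x i (n + 1)                    ≡⟨ slice-+ x i n 1 ⟩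
  slice x i n ++ x (i + n + 0) ∷ []    ≡⟨ cong (λ p → slice x i n ∷ʳ x p) (+-identityʳ (i + n)) ⟩
  slice x i n ∷ʳ x (i + n)             ∎
  where open ≡-Reasoning

slice-1 : ∀ x i → slice x i 1 ≡ x i ∷ []
slice-1 x i = cong (_∷ []) (cong x (+-identityʳ i))

slice-head : ∀ x p {n c u} → slice x p (suc n) ≡ c ∷ u → x p ≡ c
slice-head x p e = trans (cong x (sym (+-identityʳ p))) (proj₁ (∷-injective e))

slice-∷ʳ-split : ∀ x p u c → slice x p (length (u ∷ʳ c)) ≡ u ∷ʳ c → slice x p (length u) ≡ u × x (p + length u) ≡ c
slice-∷ʳ-split x p u c e = ∷ʳ-injective _ u (begin
  slice x p (length u) ∷ʳ x (p + length u)  ≡⟨ slice-∷ʳ x p (length u) ⟨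
  slice x p (suc (length u))                ≡⟨ cong (slice x p) (trans (+-comm 1 (length u)) (sym (length-++ u))) ⟩
  slice x p (length (u ∷ʳ c))               ≡⟨ e ⟩
  u ∷ʳ c                                    ∎)
  where open ≡-Reasoning

prefix-∷ʳ : ∀ x n → prefix (suc n) x ≡ prefix n x ∷ʳ x n
prefix-∷ʳ x n = slice-∷ʳ x 0 n

at-++ˡ : ∀ (u v : List Bool) {i} → i < length u → at (u ++ v) i ≡ at u i
at-++ˡ (c ∷ u) v {zero}  _        = refl
at-++ˡ (c ∷ u) v {suc i} (s≤s lt) = at-++ˡ u v lt

++ω-< : ∀ u x {n} → n < length u → (u ++ω x) n ≡ at u n
++ω-< (c ∷ u) x {zero}  _        = refl
++ω-< (c ∷ u) x {suc n} (s≤s lt) = ++ω-< u x lt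

++ω-+ : ∀ u x n → (u ++ω x) (length u + n) ≡ x n
++ω-+ []      x n = refl
++ω-+ (c ∷ u) x n = ++ω-+ u x n

prefix-++ω : ∀ u x → prefix (length u) (u ++ω x) ≡ u
prefix-++ω []      x = refl
prefix-++ω (c ∷ u) x = cong (c ∷_) (prefix-++ω u x)

prefix-++ω-shift : ∀ k x → x ≋ (prefix k x ++ω shift k x)
prefix-++ω-shift zero    x n       = refl
prefix-++ω-shift (suc k) x zero    = refl
prefix-++ω-shift (suc k) x (suc n) = prefix-++ω-shift k (shift 1 x) n

≋-++ω⇒shift : ∀ {x u S} → x ≋ (u ++ω S) → S ≋ shift (length u) x
≋-++ω⇒shift {u = u} {S} e k = sym (trans (e (length u + k)) (++ω-+ u S k))

-- Counting letters

count-++ : ∀ c u v → count c (u ++ v) ≡ count c u + count c v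
count-++ false []          v = refl
count-++ false (false ∷ u) v = cong suc (count-++ false u v)
count-++ false (true ∷ u)  v = count-++ false u v
count-++ true  []          v = refl
count-++ true  (true ∷ u)  v = cong suc (count-++ true u v)
count-++ true  (false ∷ u) v = count-++ true u v

count-[] : ∀ c → count c [] ≡ 0
count-[] false = refl
count-[] true  = refl

count-self : ∀ c u → count c (c ∷ u) ≡ suc (count c u)
count-self false u = refl
count-self true  u = refl

count-not : ∀ c u → count c (not c ∷ u) ≡ count c u
count-not false u = refl
count-not true  u = refl

count-other : ∀ c u → count (not c) (c ∷ u) ≡ count (not c) u
count-other false u = refl
count-other true  u = refl

count-∷-≤ : ∀ c d u → count c (d ∷ u) ≤ suc (count c u)
count-∷-≤ c d u with letter c d
... | is-a = ≤-reflexive (count-self c u)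
... | is-b = ≤-trans (≤-reflexive (count-not c u)) (n≤1+n _)

≤-count-∷ : ∀ c d u → count c u ≤ count c (d ∷ u)
≤-count-∷ c d u with letter c d
... | is-a = ≤-trans (n≤1+n _) (≤-reflexive (sym (count-self c u)))
... | is-b = ≤-reflexive (sym (count-not c u))

count-∷ʳ : ∀ c u d → count c (u ∷ʳ d) ≡ count c (d ∷ u)
count-∷ʳ c u d = begin
  count c (u ∷ʳ d)                  ≡⟨ count-++ c u (d ∷ []) ⟩
  count c u + count c (d ∷ [])      ≡⟨ +-comm (count c u) _ ⟩
  count c (d ∷ []) + count c u      ≡⟨ count-++ c (d ∷ []) u ⟨
  count c (d ∷ u)                   ∎
  where open ≡-Reasoning

count+count-not : ∀ c u → count c u + count (not c) u ≡ length u
count+count-not c []      = cong₂ _+_ (count-[] c) (count-[] (not c))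
count+count-not c (d ∷ u) with letter c d
... | is-a = begin
  count c (c ∷ u) + count (not c) (c ∷ u)  ≡⟨ cong₂ _+_ (count-self c u) (count-other c u) ⟩
  suc (count c u + count (not c) u)        ≡⟨ cong suc (count+count-not c u) ⟩
  suc (length u)                           ∎
  where open ≡-Reasoning
... | is-b = begin
  count c (not c ∷ u) + count (not c) (not c ∷ u)  ≡⟨ cong₂ _+_ (count-not c u) (count-self (not c) u) ⟩
  count c u + suc (count (not c) u)                ≡⟨ +-suc (count c u) _ ⟩
  suc (count c u + count (not c) u)                ≡⟨ cong suc (count+count-not c u) ⟩
  suc (length u)                                   ∎
  where open ≡-Reasoning

count≡0⇒at≡not : ∀ c u {i} → count c u ≡ 0 → i < length u → at u i ≡ not c
count≡0⇒at≡not c (d ∷ u) {i} h lt with letter c d | i | lt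
... | is-a | _     | _        = ⊥-elim (0≢1+n (trans (sym h) (count-self c u)))
... | is-b | zero  | _        = refl
... | is-b | suc i | s≤s lt′  = count≡0⇒at≡not c u (trans (sym (count-not c u)) h) lt′

-- Factors

slice≡⇒factor : ∀ x i {n u} → slice x i n ≡ u → Factor u x
slice≡⇒factor x i {n} refl = i , cong (λ m → prefix m (shift i x)) (length-slice x i n)

slice-factor : ∀ x i n → Factor (slice x i n) x
slice-factor x i n = slice≡⇒factor x i refl

factor-cong : ∀ {u x y} → x ≋ y → Factor u x → Factor u y
factor-cong {u} e (i , p) = i , trans (prefix-cong (length u) (λ n → sym (e (i + n)))) p

factor-shift : ∀ {u x} k → Factor u (shift k x) → Factor u x
factor-shift {u} {x} k (i , p) = k + i , trans (sym (slice-shift k i (length u) x)) p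

++-injective : ∀ {A : Set} (u u′ : List A) {v v′} → length u ≡ length u′ → u ++ v ≡ u′ ++ v′ → u ≡ u′ × v ≡ v′
++-injective []      []       _  e = refl , e
++-injective (c ∷ u) (c′ ∷ u′) ℓ e with refl , e′ ← ∷-injective e =
  let u≡u′ , v≡v′ = ++-injective u u′ (suc-injective ℓ) e′ in cong (c ∷_) u≡u′ , v≡v′

factor-++ : ∀ {x} u v → Factor (u ++ v) x → Factor u x × Factor v x
factor-++ {x} u v (i , p) =
  slice≡⇒factor x i (proj₁ split) , slice≡⇒factor x (i + length u) (proj₂ split)
  where
  split : slice x i (length u) ≡ u × slice x (i + length u) (length v) ≡ v
  split = ++-injective _ u (length-slice x i (length u)) (begin
    slice x i (length u) ++ slice x (i + length u) (length v) ≡⟨ slice-+ x i (length u) (length v) ⟨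
    slice x i (length u + length v)                           ≡⟨ cong (slice x i) (length-++ u) ⟨
    slice x i (length (u ++ v))                               ≡⟨ p ⟩
    u ++ v                                                    ∎)
    where open ≡-Reasoning

leftSpecial-∷ : ∀ {w x} → LeftSpecial w x → ∀ c → Factor (c ∷ w) x
leftSpecial-∷ (f₀ , f₁) false = f₀
leftSpecial-∷ (f₀ , f₁) true  = f₁

-- Balance

∸≤1⇒≤suc : ∀ m n → m ∸ n ≤ 1 → m ≤ suc n
∸≤1⇒≤suc zero    n       _ = z≤n
∸≤1⇒≤suc (suc m) zero    h = h
∸≤1⇒≤suc (suc m) (suc n) h = s≤s (∸≤1⇒≤suc m n h)

≤suc⇒∸≤1 : ∀ m n → m ≤ suc n → m ∸ n ≤ 1
≤suc⇒∸≤1 m n h = m≤n+o⇒m∸n≤o m n (subst (m ≤_) (+-comm 1 n) h)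

BalancedIn : Bool → Word → Set
BalancedIn c x = ∀ i j n → count c (slice x j n) ≤ suc (count c (slice x i n))

balanced-count : ∀ {x u v} → Balanced x → Factor u x → Factor v x → length u ≡ length v →
                 ∀ c → count c u ≤ suc (count c v)
balanced-count bx fu fv ℓ c = ∸≤1⇒≤suc _ _ (proj₁ (bx _ _ fu fv ℓ c))

balanced⇒balancedIn : ∀ {x} → Balanced x → ∀ c → BalancedIn c x
balanced⇒balancedIn {x} bx c i j n =
  balanced-count {x} bx (slice-factor x j n) (slice-factor x i n) (trans (length-slice x j n) (sym (length-slice x i n))) c

balancedIn-not : ∀ {x} c → BalancedIn c x → BalancedIn (not c) x
balancedIn-not {x} c bc i j n = +-cancelʳ-≤ (count c (slice x j n)) _ _ (begin
  count (not c) (slice x j n) + count c (slice x j n)  ≡⟨ +-comm _ (count c (slice x j n)) ⟩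
  count c (slice x j n) + count (not c) (slice x j n)  ≡⟨ trans (count+count-not c _) (length-slice x j n) ⟩
  n                                                     ≡⟨ trans (count+count-not c _) (length-slice x i n) ⟨
  count c (slice x i n) + count (not c) (slice x i n)  ≤⟨ +-monoˡ-≤ _ (bc j i n) ⟩
  suc (count c (slice x j n)) + count (not c) (slice x i n) ≡⟨ cong suc (+-comm (count c (slice x j n)) _) ⟩
  suc (count (not c) (slice x i n)) + count c (slice x j n) ∎)
  where open ≤-Reasoning

balancedIn⇒balanced : ∀ {x} c → BalancedIn c x → Balanced x
balancedIn⇒balanced {x} c bc u v (i , u≡) (j , v≡) ℓ c′ =
  ≤suc⇒∸≤1 _ _ (subst₂ within u≡ v≡′ (bound i j)) , ≤suc⇒∸≤1 _ _ (subst₂ within v≡′ u≡ (bound j i))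
  where
  within : List Bool → List Bool → Set
  within s t = count c′ s ≤ suc (count c′ t)
  v≡′ : slice x j (length u) ≡ v
  v≡′ = trans (cong (slice x j) ℓ) v≡
  bound : ∀ i j → within (slice x i (length u)) (slice x j (length u))
  bound i j with letter c c′
  ... | is-a = bc j i (length u)
  ... | is-b = balancedIn-not {x} c bc j i (length u)

count-slice-mono : ∀ c x i {d d′} → d ≤ d′ → count c (slice x i d) ≤ count c (slice x i d′)
count-slice-mono c x i {d} d≤d′ with e , refl ← m≤n⇒∃[o]m+o≡n d≤d′ =
  ≤-trans (m≤m+n _ _) (≤-reflexive (sym (trans (cong (count c) (slice-+ x i d e)) (count-++ c (slice x i d) _))))

count-drop : ∀ c d e u v → (e ≡ not c ⊎ d ≡ c) → 2 + count c (d ∷ u) ≤ count c (e ∷ v) → 2 + count c u ≤ count c v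
count-drop c d e u v (inj₁ refl) h = ≤-trans (+-monoʳ-≤ 2 (≤-count-∷ c d u)) (≤-trans h (≤-reflexive (count-not c v)))
count-drop c d e u v (inj₂ refl) h = s≤s⁻¹ (begin
  suc (2 + count c u)   ≡⟨ cong (2 +_) (count-self c u) ⟨
  2 + count c (c ∷ u)   ≤⟨ h ⟩
  count c (e ∷ v)       ≤⟨ count-∷-≤ c e v ⟩
  suc (count c v)       ∎)
  where open ≤-Reasoning

count-drop-first : ∀ c x i j n → (x j ≡ not c ⊎ x i ≡ c) →
  2 + count c (slice x i (suc n)) ≤ count c (slice x j (suc n)) → 2 + count c (slice x (suc i) n) ≤ count c (slice x (suc j) n)
count-drop-first c x i j n cases h =
  count-drop c (x i) (x j) _ _ cases (subst₂ (λ u v → 2 + count c u ≤ count c v) (slice-suc x i n) (slice-suc x j n) h)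

count-drop-last : ∀ c x i j n → (x (j + n) ≡ not c ⊎ x (i + n) ≡ c) →
  2 + count c (slice x i (suc n)) ≤ count c (slice x j (suc n)) → 2 + count c (slice x i n) ≤ count c (slice x j n)
count-drop-last c x i j n cases h = count-drop c (x (i + n)) (x (j + n)) _ _ cases (subst₂ (λ u v → 2 + u ≤ v)
  (trans (cong (count c) (slice-∷ʳ x i n)) (count-∷ʳ c _ _)) (trans (cong (count c) (slice-∷ʳ x j n)) (count-∷ʳ c _ _)) h)

count-slice-step : ∀ c x s p → x (s + p) ≡ x s → count c (slice x (suc s) p) ≡ count c (slice x s p)
count-slice-step c x s p e = +-cancelˡ-≡ (count c (x s ∷ [])) _ _ (begin
  count c (x s ∷ []) + count c (slice x (suc s) p)  ≡⟨ count-++ c (x s ∷ []) _ ⟨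
  count c (x s ∷ slice x (suc s) p)                 ≡⟨ cong (count c) (slice-suc x s p) ⟨
  count c (slice x s (suc p))                       ≡⟨ cong (count c) (slice-∷ʳ x s p) ⟩
  count c (slice x s p ∷ʳ x (s + p))                ≡⟨ count-∷ʳ c _ _ ⟩
  count c (x (s + p) ∷ slice x s p)                 ≡⟨ cong (λ d → count c (d ∷ slice x s p)) e ⟩
  count c (x s ∷ [] ++ slice x s p)                 ≡⟨ count-++ c (x s ∷ []) _ ⟩
  count c (x s ∷ []) + count c (slice x s p)        ∎)
  where open ≡-Reasoning

periodic-count : ∀ c x {p N} → (∀ n → N ≤ n → x (n + p) ≡ x n) →
                 ∀ {s} → N ≤ s → count c (slice x s p) ≡ count c (slice x N p)
periodic-count c x {p} {N} per N≤s with d , refl ← m≤n⇒∃[o]m+o≡n N≤s = go d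
  where
  go : ∀ d → count c (slice x (N + d) p) ≡ count c (slice x N p)
  go zero    = cong (λ s → count c (slice x s p)) (+-identityʳ N)
  go (suc d) = trans (cong (λ s → count c (slice x s p)) (+-suc N d)) (trans (count-slice-step c x (N + d) p (per (N + d) (m≤m+n N d))) (go d))

-- Sturmian and singular words under equality and shifts

balanced-factors : ∀ {x y} → (∀ {u} → Factor u y → Factor u x) → Balanced x → Balanced y
balanced-factors y⊆x bx u v fu fv = bx u v (y⊆x fu) (y⊆x fv)

ultimatelyPeriodic-cong : ∀ {x y} → x ≋ y → UltimatelyPeriodic x → UltimatelyPeriodic y
ultimatelyPeriodic-cong e (p , p>0 , N , per) = p , p>0 , N , λ n N≤n → trans (sym (e (n + p))) (trans (per n N≤n) (e n))

ultimatelyPeriodic-shift : ∀ {x} k → UltimatelyPeriodic (shift k x) → UltimatelyPeriodic x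
ultimatelyPeriodic-shift {x} k (p , p>0 , N , per) = p , p>0 , k + N , per′
  where
  per′ : ∀ n → k + N ≤ n → x (n + p) ≡ x n
  per′ n le with d , refl ← m≤n⇒∃[o]m+o≡n le =
    trans (cong x (trans (+-assoc (k + N) d p) (trans (+-assoc k N (d + p)) (cong (k +_) (sym (+-assoc N d p))))))
          (trans (per (N + d) (m≤m+n N d)) (cong x (sym (+-assoc k N d))))

sturmian-cong : ∀ {x y} → x ≋ y → Sturmian x → Sturmian y
sturmian-cong {x} {y} e (ax , bx) =
  ax ∘ ultimatelyPeriodic-cong (≋-sym {x} {y} e) , balanced-factors {x} {y} (factor-cong (≋-sym {x} {y} e)) bx

sturmian-shift : ∀ {x} k → Sturmian x → Sturmian (shift k x)
sturmian-shift {x} k (ax , bx) = (λ up → ax (ultimatelyPeriodic-shift k up)) , balanced-factors {x} {shift k x} (factor-shift {x = x} k) bx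

standard-cong : ∀ {x y} → x ≋ y → StandardSturmian x → StandardSturmian y
standard-cong {x} {y} e (sx , ls) =
  sturmian-cong e sx , λ n → subst (λ w → LeftSpecial w y) (prefix-cong n e) (factor-cong e (proj₁ (ls n)) , factor-cong e (proj₂ (ls n)))

singular-cong : ∀ {x y} → x ≋ y → Singular x → Singular y
singular-cong e (u , S , ℓ , st , e′) = u , S , ℓ , st , ≋-trans (≋-sym e) e′

-- Prefixes of singular decompositions

doubled-letter-before : ∀ {z} P c → Balanced z → Factor (not c ∷ not c ∷ P) z → Factor (c ∷ (P ∷ʳ c)) z → ⊥
doubled-letter-before {z} P c bz fA fB = 1+n≰n (s≤s⁻¹ (begin
  suc (suc (count c P))              ≡⟨ cong suc (trans (count-∷ʳ c P c) (count-self c P)) ⟨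
  suc (count c (P ∷ʳ c))             ≡⟨ count-self c (P ∷ʳ c) ⟨
  count c (c ∷ (P ∷ʳ c))             ≤⟨ balanced-count {z} bz fB fA ℓ c ⟩
  suc (count c (not c ∷ not c ∷ P))  ≡⟨ cong suc (trans (count-not c _) (count-not c P)) ⟩
  suc (count c P)                    ∎))
  where
  open ≤-Reasoning
  ℓ : length (c ∷ (P ∷ʳ c)) ≡ length (not c ∷ not c ∷ P)
  ℓ = cong suc (trans (length-++ P) (+-comm (length P) 1))

long-prefix-contains : ∀ {z u S} c → Sturmian z → StandardSturmian S → z ≋ (u ++ω S) → 2 ≤ length u → 1 ≤ count c u
long-prefix-contains {z} {u} {S} c (az , bz) (_ , ls) e 2≤ℓ with count c u in count≡0
... | suc _ = s≤s z≤n
... | zero  = ⊥-elim (az (1 , s≤s z≤n , length u , constant-tail))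
  where
  d : Bool
  d = not c
  r : ℕ
  r = proj₁ (m≤n⇒∃[o]m+o≡n 2≤ℓ)
  2+r≡ℓ : 2 + r ≡ length u
  2+r≡ℓ = proj₂ (m≤n⇒∃[o]m+o≡n 2≤ℓ)
  z-in-u : ∀ {i} → i < length u → z i ≡ d
  z-in-u lt = trans (e _) (trans (++ω-< u S lt) (count≡0⇒at≡not c u count≡0 lt))
  S≡shift : S ≋ shift (2 + r) z
  S≡shift k = trans (≋-++ω⇒shift {u = u} e k) (cong (λ m → z (m + k)) (sym 2+r≡ℓ))
  dd-factor : ∀ n → Factor (d ∷ d ∷ prefix n S) z
  dd-factor n = slice≡⇒factor z r (begin
    slice z r (2 + n)                  ≡⟨ trans (slice-suc z r (suc n)) (cong (z r ∷_) (slice-suc z (suc r) n)) ⟩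
    z r ∷ z (suc r) ∷ slice z (2 + r) n ≡⟨ cong₂ (λ p q → p ∷ q ∷ slice z (2 + r) n)
                                              (z-in-u (≤-trans (n≤1+n _) (≤-reflexive 2+r≡ℓ))) (z-in-u (≤-reflexive 2+r≡ℓ)) ⟩
    d ∷ d ∷ slice z (2 + r) n          ≡⟨ cong (λ w → d ∷ d ∷ w) (prefix-cong n S≡shift) ⟨
    d ∷ d ∷ prefix n S                 ∎)
    where open ≡-Reasoning
  S≡d : ∀ n → S n ≡ d
  S≡d n with S n in Sn | letter c (S n)
  ... | _ | is-b = refl
  ... | _ | is-a = ⊥-elim (doubled-letter-before {z} (prefix n S) c bz (dd-factor n)
                     (subst (λ w → Factor (c ∷ w) z) (trans (prefix-∷ʳ S n) (cong (prefix n S ∷ʳ_) Sn))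
                       (factor-shift {x = z} (length u) (factor-cong (≋-++ω⇒shift {z} {u} {S} e) (leftSpecial-∷ {x = S} (ls (suc n)) c)))))
  constant-tail : ∀ n → length u ≤ n → z (n + 1) ≡ z n
  constant-tail n le with k , refl ← m≤n⇒∃[o]m+o≡n le = begin
    z (length u + k + 1)    ≡⟨ cong z (trans (+-assoc (length u) k 1) (cong (length u +_) (+-comm k 1))) ⟩
    z (length u + suc k)    ≡⟨ trans (e _) (++ω-+ u S (suc k)) ⟩
    S (suc k)               ≡⟨ trans (S≡d (suc k)) (sym (S≡d k)) ⟩
    S k                     ≡⟨ trans (e _) (++ω-+ u S k) ⟨
    z (length u + k)        ∎
    where open ≡-Reasoning

-- Non-erasing morphisms and their extension to infinite words

record IsNonErasingMorphism (F : List Bool → List Bool) : Set where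
  field
    homo     : ∀ u v → F (u ++ v) ≡ F u ++ F v
    length-≤ : ∀ u → length u ≤ length (F u)

extend : (List Bool → List Bool) → Word → Word
extend F y n = at (F (prefix (suc n) y)) n

extend-cong : ∀ F {y y′} → y ≋ y′ → extend F y ≋ extend F y′
extend-cong F e n = cong (λ w → at (F w) n) (prefix-cong (suc n) e)

prefix-++ω-+ : ∀ u x n → prefix (length u + n) (u ++ω x) ≡ u ++ prefix n x
prefix-++ω-+ u x n = trans (prefix-+ (length u) n (u ++ω x)) (cong₂ _++_ (prefix-++ω u x) (prefix-cong n (λ k → ++ω-+ u x k)))

∘-isNonErasingMorphism : ∀ {F G} → IsNonErasingMorphism F → IsNonErasingMorphism G → IsNonErasingMorphism (G ∘ F)
∘-isNonErasingMorphism {F} {G} MF MG = record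
  { homo     = λ u v → trans (cong G (homo MF u v)) (homo MG (F u) (F v))
  ; length-≤ = λ u → ≤-trans (length-≤ MF u) (length-≤ MG (F u))
  }
  where open IsNonErasingMorphism

concatMap-isNonErasingMorphism : (m : Bool → List Bool) → (∀ c → 1 ≤ length (m c)) → IsNonErasingMorphism (concatMap m)
concatMap-isNonErasingMorphism m m≢[] = record { homo = concatMap-++ m ; length-≤ = length-≤ }
  where
  length-≤ : ∀ u → length u ≤ length (concatMap m u)
  length-≤ []      = z≤n
  length-≤ (c ∷ u) = ≤-trans (+-mono-≤ (m≢[] c) (length-≤ u)) (≤-reflexive (sym (length-++ (m c))))

module Image {F : List Bool → List Bool} (M : IsNonErasingMorphism F) where
  open IsNonErasingMorphism M

  pos : Word → ℕ → ℕ
  pos y k = length (F (prefix k y))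

  ≤-pos : ∀ y k → k ≤ pos y k
  ≤-pos y k = subst (_≤ pos y k) (length-prefix k y) (length-≤ (prefix k y))

  F-prefix-+ : ∀ y k d → F (prefix (k + d) y) ≡ F (prefix k y) ++ F (slice y k d)
  F-prefix-+ y k d = trans (cong F (prefix-+ k d y)) (homo (prefix k y) (slice y k d))

  pos-+ : ∀ y k d → pos y (k + d) ≡ pos y k + length (F (slice y k d))
  pos-+ y k d = trans (cong length (F-prefix-+ y k d)) (length-++ (F (prefix k y)))

  at-F-prefix-+ : ∀ y k d {n} → n < pos y k → at (F (prefix (k + d) y)) n ≡ at (F (prefix k y)) n
  at-F-prefix-+ y k d lt = trans (cong (λ w → at w _) (F-prefix-+ y k d)) (at-++ˡ (F (prefix k y)) _ lt)

  at-F-prefix : ∀ y k {n} → n < pos y k → at (F (prefix k y)) n ≡ extend F y n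
  at-F-prefix y k {n} lt with ≤-<-connex (suc n) k
  ... | inj₁ 1+n≤k with d , refl ← m≤n⇒∃[o]m+o≡n 1+n≤k = at-F-prefix-+ y (suc n) d (≤-pos y (suc n))
  ... | inj₂ k<1+n with d , k+d≡1+n ← m≤n⇒∃[o]m+o≡n (<⇒≤ k<1+n) =
    sym (trans (cong (λ j → at (F (prefix j y)) n) (sym k+d≡1+n)) (at-F-prefix-+ y k d lt))

  F-prefix : ∀ y k → prefix (pos y k) (extend F y) ≡ F (prefix k y)
  F-prefix y k = prefix-unique (F (prefix k y)) (extend F y) (λ lt → at-F-prefix y k lt)

  extend-unique : ∀ y X m → (∀ k → prefix (pos y (m + k)) X ≡ F (prefix (m + k) y)) → extend F y ≋ X
  extend-unique y X m agree n = begin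
    extend F y n                     ≡⟨ at-F-prefix y (m + suc n) n<pos ⟨
    at (F (prefix (m + suc n) y)) n  ≡⟨ cong (λ w → at w n) (agree (suc n)) ⟨
    at (prefix (pos y (m + suc n)) X) n ≡⟨ at-prefix X n<pos ⟩
    X n                              ∎
    where
    open ≡-Reasoning
    n<pos : n < pos y (m + suc n)
    n<pos = ≤-trans (m≤n+m (suc n) m) (≤-pos y (m + suc n))

  extend-++ω : ∀ u z → extend F (u ++ω z) ≋ (F u ++ω extend F z)
  extend-++ω u z = extend-unique (u ++ω z) _ (length u) agree
    where
    open ≡-Reasoning
    agree : ∀ k → prefix (pos (u ++ω z) (length u + k)) (F u ++ω extend F z) ≡ F (prefix (length u + k) (u ++ω z))
    agree k = begin
      prefix (pos (u ++ω z) (length u + k)) (F u ++ω extend F z) ≡⟨ cong (λ w → prefix (length (F w)) _) (prefix-++ω-+ u z k) ⟩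
      prefix (length (F (u ++ prefix k z))) (F u ++ω extend F z) ≡⟨ cong (λ w → prefix (length w) _) (homo u (prefix k z)) ⟩
      prefix (length (F u ++ F (prefix k z))) (F u ++ω extend F z) ≡⟨ cong (λ n → prefix n _) (length-++ (F u)) ⟩
      prefix (length (F u) + pos z k) (F u ++ω extend F z)       ≡⟨ prefix-++ω-+ (F u) (extend F z) (pos z k) ⟩
      F u ++ prefix (pos z k) (extend F z)                        ≡⟨ cong (F u ++_) (F-prefix z k) ⟩
      F u ++ F (prefix k z)                                       ≡⟨ homo u (prefix k z) ⟨
      F (u ++ prefix k z)                                         ≡⟨ cong F (prefix-++ω-+ u z k) ⟨
      F (prefix (length u + k) (u ++ω z))                         ∎

  slice-pos : ∀ y k d → slice (extend F y) (pos y k) (length (F (slice y k d))) ≡ F (slice y k d)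
  slice-pos y k d = ++-cancelˡ (F (prefix k y)) _ _ (begin
    F (prefix k y) ++ slice X (pos y k) ℓ          ≡⟨ cong (_++ slice X (pos y k) ℓ) (F-prefix y k) ⟨
    prefix (pos y k) X ++ slice X (pos y k) ℓ      ≡⟨ prefix-+ (pos y k) ℓ X ⟨
    prefix (pos y k + ℓ) X                         ≡⟨ cong (λ n → prefix n X) (pos-+ y k d) ⟨
    prefix (pos y (k + d)) X                       ≡⟨ F-prefix y (k + d) ⟩
    F (prefix (k + d) y)                           ≡⟨ F-prefix-+ y k d ⟩
    F (prefix k y) ++ F (slice y k d)              ∎)
    where
    open ≡-Reasoning
    X : Word
    X = extend F y
    ℓ : ℕ
    ℓ = length (F (slice y k d))

  factor-extend : ∀ {v y} → Factor v y → Factor (F v) (extend F y)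
  factor-extend {v} {y} (i , v≡) = slice≡⇒factor (extend F y) (pos y i)
    (subst (λ w → slice (extend F y) (pos y i) (length (F w)) ≡ F w) v≡ (slice-pos y i (length v)))

extend-∘ : ∀ {F G} → IsNonErasingMorphism F → IsNonErasingMorphism G → ∀ y → extend (G ∘ F) y ≋ extend G (extend F y)
extend-∘ {F} {G} MF MG y = Image.extend-unique (∘-isNonErasingMorphism MF MG) y _ 0 agree
  where
  agree : ∀ k → prefix (length (G (F (prefix k y)))) (extend G (extend F y)) ≡ G (F (prefix k y))
  agree k = begin
    prefix (length (G (F (prefix k y)))) (extend G (extend F y))  ≡⟨ cong (λ w → prefix (length (G w)) _) (Image.F-prefix MF y k) ⟨
    prefix (Image.pos MG (extend F y) (Image.pos MF y k)) (extend G (extend F y)) ≡⟨ Image.F-prefix MG (extend F y) (Image.pos MF y k) ⟩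
    G (prefix (Image.pos MF y k) (extend F y))                           ≡⟨ cong G (Image.F-prefix MF y k) ⟩
    G (F (prefix k y))                                             ∎
    where open ≡-Reasoning

SingularGrowth : Set → Word → Word → Set
SingularGrowth P z x = ∀ u S → 2 ≤ length u → StandardSturmian S → z ≋ (u ++ω S) →
  ∃ λ u₂ → ∃ λ S₂ → StandardSturmian S₂ × (length u ≤ length u₂) × (x ≋ (u₂ ++ω S₂)) × (P → length u < length u₂)

record Transfer (P : Set) (z x : Word) : Set where
  field
    sturmian         : Sturmian x
    singular-reflect : Singular x → Singular z
    singular-growth  : SingularGrowth P z x
open Transfer

transfer-cong : ∀ {P z x x′} → x ≋ x′ → Transfer P z x → Transfer P z x′
transfer-cong {x = x} {x′} e t = record
  { sturmian         = sturmian-cong e (sturmian t)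
  ; singular-reflect = singular-reflect t ∘ singular-cong (≋-sym {x} {x′} e)
  ; singular-growth  = λ u S 2≤u stS z≋uS → let u₂ , S₂ , stS₂ , u≤u₂ , x≋ , strict = singular-growth t u S 2≤u stS z≋uS in
                         u₂ , S₂ , stS₂ , u≤u₂ , ≋-trans (≋-sym {x} {x′} e) x≋ , strict
  }

transfer-refl : ∀ {P y} → (P → ⊥) → Sturmian y → Transfer P y y
transfer-refl ¬P sy = record
  { sturmian         = sy
  ; singular-reflect = λ s → s
  ; singular-growth  = λ u S 2≤u stS y≋uS → u , S , stS , ≤-refl , y≋uS , ⊥-elim ∘ ¬P
  }

transfer-∘ : ∀ {P Q y z x} → Transfer P y z → Transfer Q z x → Transfer (Q ⊎ P) y x
transfer-∘ {P} {Q} {y} {z} {x} t t′ = record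
  { sturmian         = sturmian t′
  ; singular-reflect = singular-reflect t ∘ singular-reflect t′
  ; singular-growth  = growth
  }
  where
  growth : SingularGrowth (Q ⊎ P) y x
  growth u S 2≤u stS y≋uS with u₁ , S₁ , stS₁ , u≤u₁ , z≋ , strict₁ ← singular-growth t u S 2≤u stS y≋uS
    with u₂ , S₂ , stS₂ , u₁≤u₂ , x≋ , strict₂ ← singular-growth t′ u₁ S₁ (≤-trans 2≤u u≤u₁) stS₁ z≋ =
    u₂ , S₂ , stS₂ , ≤-trans u≤u₁ u₁≤u₂ , x≋ , strict
    where
    strict : Q ⊎ P → length u < length u₂
    strict (inj₁ q) = ≤-<-trans u≤u₁ (strict₂ q)
    strict (inj₂ p) = <-≤-trans (strict₁ p) u₁≤u₂

transfer-weaken : ∀ {P Q z x} → (Q → P) → Transfer P z x → Transfer Q z x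
transfer-weaken Q⇒P t = record
  { sturmian         = sturmian t
  ; singular-reflect = singular-reflect t
  ; singular-growth  = λ u S 2≤u stS z≋uS → let u₂ , S₂ , stS₂ , u≤u₂ , x≋ , strict = singular-growth t u S 2≤u stS z≋uS in
                         u₂ , S₂ , stS₂ , u≤u₂ , x≋ , strict ∘ Q⇒P
  }

module LeftMorphism (a : Bool) (m : Bool → List Bool) (m-a : m a ≡ a ∷ []) (m-b : m (not a) ≡ a ∷ not a ∷ []) where

  b : Bool
  b = not a

  a≢b : a ≡ b → ⊥
  a≢b = not-¬ refl

  F : List Bool → List Bool
  F = concatMap m

  m-nonempty : ∀ c → 1 ≤ length (m c)
  m-nonempty c with letter a c
  ... | is-a rewrite m-a = s≤s z≤n
  ... | is-b rewrite m-b = s≤s z≤n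

  m-∷ʳ : ∀ c → ∃ λ w → m c ≡ w ∷ʳ c
  m-∷ʳ c with letter a c
  ... | is-a = [] , m-a
  ... | is-b = a ∷ [] , m-b

  M : IsNonErasingMorphism F
  M = concatMap-isNonErasingMorphism m m-nonempty

  length-F : ∀ w → length (F w) ≡ length w + count b w
  length-F []      = sym (count-[] b)
  length-F (c ∷ w) with letter a c
  ... | is-a rewrite m-a = cong suc (trans (length-F w) (cong (length w +_) (sym (count-other a w))))
  ... | is-b rewrite m-b = cong suc (begin
    suc (length (F w))         ≡⟨ cong suc (length-F w) ⟩
    suc (length w + count b w) ≡⟨ +-suc (length w) _ ⟨
    length w + suc (count b w) ≡⟨ cong (length w +_) (count-self b w) ⟨
    length w + count b (b ∷ w) ∎)
    where open ≡-Reasoning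

  count-b-F : ∀ w → count b (F w) ≡ count b w
  count-b-F []      = refl
  count-b-F (c ∷ w) with letter a c
  ... | is-a rewrite m-a = trans (count-other a (F w)) (trans (count-b-F w) (sym (count-other a w)))
  ... | is-b rewrite m-b = trans (count-other a (b ∷ F w)) (trans (count-self b (F w)) (trans (cong suc (count-b-F w)) (sym (count-self b w))))

  count-a-F : ∀ w → count a (F w) ≡ length w
  count-a-F []      = count-[] a
  count-a-F (c ∷ w) with letter a c
  ... | is-a rewrite m-a = trans (count-self a (F w)) (cong suc (count-a-F w))
  ... | is-b rewrite m-b = trans (count-self a (b ∷ F w)) (cong suc (trans (count-not a (F w)) (count-a-F w)))

  m-head : ∀ c → ∃ λ t → m c ≡ a ∷ t
  m-head c with letter a c
  ... | is-a = [] , m-a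
  ... | is-b = b ∷ [] , m-b

  F-∷ : ∀ c w → ∃ λ t → F (c ∷ w) ≡ a ∷ t
  F-∷ c w with t , e ← m-head c = t ++ F w , cong (_++ F w) e

  F≢b∷ : ∀ v {t} → F v ≡ b ∷ t → ⊥
  F≢b∷ []      ()
  F≢b∷ (c ∷ v) e with t , e′ ← F-∷ c v = a≢b (proj₁ (∷-injective (trans (sym e′) e)))

  F-injective : ∀ v w → F v ≡ F w → v ≡ w
  F-injective []      []      _ = refl
  F-injective []      (d ∷ w) e with t , e′ ← F-∷ d w with () ← trans e e′
  F-injective (c ∷ v) []      e with t , e′ ← F-∷ c v with () ← trans (sym e) e′
  F-injective (c ∷ v) (d ∷ w) e with letter a c | letter a d
  ... | is-a | is-a rewrite m-a = cong (a ∷_) (F-injective v w (∷-injectiveʳ e))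
  ... | is-b | is-b rewrite m-b = cong (b ∷_) (F-injective v w (∷-injectiveʳ (∷-injectiveʳ e)))
  ... | is-a | is-b rewrite m-a | m-b = ⊥-elim (F≢b∷ v (∷-injectiveʳ e))
  ... | is-b | is-a rewrite m-a | m-b = ⊥-elim (F≢b∷ w (sym (∷-injectiveʳ e)))

  open Image M public

  Lω : Word → Word
  Lω = extend F

  pos-suc : ∀ z k → pos z (suc k) ≡ pos z k + length (m (z k))
  pos-suc z k = begin
    pos z (suc k)                          ≡⟨ cong (pos z) (+-comm 1 k) ⟩
    pos z (k + 1)                          ≡⟨ pos-+ z k 1 ⟩
    pos z k + length (F (slice z k 1))     ≡⟨ cong (λ w → pos z k + length (F w)) (slice-1 z k) ⟩
    pos z k + length (m (z k) ++ [])       ≡⟨ cong (λ w → pos z k + length w) (++-identityʳ (m (z k))) ⟩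
    pos z k + length (m (z k))             ∎
    where open ≡-Reasoning

  pos-suc-a : ∀ z k → z k ≡ a → pos z (suc k) ≡ suc (pos z k)
  pos-suc-a z k zk = begin
    pos z (suc k)               ≡⟨ pos-suc z k ⟩
    pos z k + length (m (z k))  ≡⟨ cong (λ c → pos z k + length (m c)) zk ⟩
    pos z k + length (m a)      ≡⟨ cong (λ w → pos z k + length w) m-a ⟩
    pos z k + 1                 ≡⟨ +-comm (pos z k) 1 ⟩
    suc (pos z k)               ∎
    where open ≡-Reasoning

  pos-suc-b : ∀ z k → z k ≡ b → pos z (suc k) ≡ suc (suc (pos z k))
  pos-suc-b z k zk = begin
    pos z (suc k)               ≡⟨ pos-suc z k ⟩
    pos z k + length (m (z k))  ≡⟨ cong (λ c → pos z k + length (m c)) zk ⟩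
    pos z k + length (m b)      ≡⟨ cong (λ w → pos z k + length w) m-b ⟩
    pos z k + 2                 ≡⟨ +-comm (pos z k) 2 ⟩
    suc (suc (pos z k))         ∎
    where open ≡-Reasoning

  Lω-block : ∀ z k {i} → i < length (m (z k)) → Lω z (pos z k + i) ≡ at (m (z k)) i
  Lω-block z k {i} lt = begin
    Lω z (pos z k + i)                                ≡⟨ at-slice (Lω z) (pos z k) lt ⟨
    at (slice (Lω z) (pos z k) (length (m (z k)))) i  ≡⟨ cong (λ w → at (slice (Lω z) (pos z k) (length w)) i) F-slice-1 ⟨
    at (slice (Lω z) (pos z k) (length (F (slice z k 1)))) i ≡⟨ cong (λ w → at w i) (slice-pos z k 1) ⟩
    at (F (slice z k 1)) i                             ≡⟨ cong (λ w → at w i) F-slice-1 ⟩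
    at (m (z k)) i                                     ∎
    where
    open ≡-Reasoning
    F-slice-1 : F (slice z k 1) ≡ m (z k)
    F-slice-1 = trans (cong F (slice-1 z k)) (++-identityʳ (m (z k)))

  Lω-pos : ∀ z k → Lω z (pos z k) ≡ a
  Lω-pos z k with t , e ← m-head (z k) = begin
    Lω z (pos z k)        ≡⟨ cong (Lω z) (+-identityʳ (pos z k)) ⟨
    Lω z (pos z k + 0)    ≡⟨ Lω-block z k (m-nonempty (z k)) ⟩
    at (m (z k)) 0        ≡⟨ cong (λ w → at w 0) e ⟩
    a                     ∎
    where open ≡-Reasoning

  Lω-suc-pos : ∀ z k → Lω z (suc (pos z k)) ≡ z k
  Lω-suc-pos z k with z k in zk | letter a (z k)
  ... | _ | is-a = trans (cong (Lω z) (sym (pos-suc-a z k zk))) (Lω-pos z (suc k))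
  ... | _ | is-b = begin
    Lω z (suc (pos z k))  ≡⟨ cong (Lω z) (+-comm 1 (pos z k)) ⟩
    Lω z (pos z k + 1)    ≡⟨ Lω-block z k (subst (λ c → 1 < length (m c)) (sym zk) (subst (λ w → 1 < length w) (sym m-b) ≤-refl)) ⟩
    at (m (z k)) 1        ≡⟨ cong (λ c → at (m c) 1) zk ⟩
    at (m b) 1            ≡⟨ cong (λ w → at w 1) m-b ⟩
    b                     ∎
    where open ≡-Reasoning

  prefix-suc-pos : ∀ y n → prefix (suc (pos y n)) (Lω y) ≡ F (prefix n y) ∷ʳ a
  prefix-suc-pos y n = trans (prefix-∷ʳ (Lω y) (pos y n)) (cong₂ _∷ʳ_ (F-prefix y n) (Lω-pos y n))

  pos-<-suc : ∀ z k → pos z k < pos z (suc k)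
  pos-<-suc z k = begin
    suc (pos z k)                 ≡⟨ +-comm 1 (pos z k) ⟩
    pos z k + 1                   ≤⟨ +-monoʳ-≤ (pos z k) (m-nonempty (z k)) ⟩
    pos z k + length (m (z k))    ≡⟨ pos-suc z k ⟨
    pos z (suc k)                 ∎
    where open ≤-Reasoning

  pos-monoʳ : ∀ z k d → pos z k ≤ pos z (k + d)
  pos-monoʳ z k d = ≤-trans (m≤m+n (pos z k) _) (≤-reflexive (sym (pos-+ z k d)))

  pos-strictMono : ∀ z {k k′} → k < k′ → pos z k < pos z k′
  pos-strictMono z {k} k<k′ with d , refl ← m≤n⇒∃[o]m+o≡n k<k′ = ≤-trans (pos-<-suc z k) (pos-monoʳ z (suc k) d)

  pos-cancel-≤ : ∀ z {k k′} → pos z k ≤ pos z k′ → k ≤ k′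
  pos-cancel-≤ z {k} {k′} le with k ≤? k′
  ... | yes k≤k′ = k≤k′
  ... | no  k≰k′ = ⊥-elim (<⇒≱ (pos-strictMono z (≰⇒> k≰k′)) le)

  pos-or-suc-pos : ∀ z n → ∃ λ k → n ≡ pos z k ⊎ (n ≡ suc (pos z k) × z k ≡ b)
  pos-or-suc-pos z zero    = 0 , inj₁ refl
  pos-or-suc-pos z (suc n) with pos-or-suc-pos z n
  ... | k , inj₂ (refl , zk) = suc k , inj₁ (sym (pos-suc-b z k zk))
  ... | k , inj₁ refl with z k in zk | letter a (z k)
  ...   | _ | is-a = suc k , inj₁ (sym (pos-suc-a z k zk))
  ...   | _ | is-b = k , inj₂ (refl , zk)

  a⇒pos : ∀ z n → Lω z n ≡ a → ∃ λ k → n ≡ pos z k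
  a⇒pos z n e with pos-or-suc-pos z n
  ... | k , inj₁ n≡pos       = k , n≡pos
  ... | k , inj₂ (refl , zk) = ⊥-elim (a≢b (trans (sym e) (trans (Lω-suc-pos z k) zk)))

  b⇒suc-pos : ∀ z n → Lω z n ≡ b → ∃ λ k → n ≡ suc (pos z k)
  b⇒suc-pos z n e with pos-or-suc-pos z n
  ... | k , inj₁ refl        = ⊥-elim (a≢b (trans (sym (Lω-pos z k)) e))
  ... | k , inj₂ (n≡suc , _) = k , n≡suc

  b-followed-by-a : ∀ z n → Lω z n ≡ b → Lω z (suc n) ≡ a
  b-followed-by-a z n e with b⇒suc-pos z n e
  ... | k , refl = trans (cong (Lω z) (sym (pos-suc-b z k (trans (sym (Lω-suc-pos z k)) e)))) (Lω-pos z (suc k))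

  a-delimited : ∀ z k n → Lω z (pos z k + n) ≡ a → ∃ λ d → slice (Lω z) (pos z k) n ≡ F (slice z k d)
  a-delimited z k n e with k′ , e′ ← a⇒pos z _ e
    with d , refl ← m≤n⇒∃[o]m+o≡n (pos-cancel-≤ z {k} {k′} (subst (pos z k ≤_) e′ (m≤m+n _ n))) =
    d , subst (λ ℓ → slice (Lω z) (pos z k) ℓ ≡ F (slice z k d)) (sym n≡ℓ) (slice-pos z k d)
    where
    n≡ℓ : n ≡ length (F (slice z k d))
    n≡ℓ = +-cancelˡ-≡ (pos z k) _ _ (trans e′ (pos-+ z k d))

  a≡not-b : a ≡ not b
  a≡not-b = sym (not-involutive a)

  image-counts : ∀ {x p n} z k d → slice x p n ≡ F (slice z k d) →
                 n ≡ d + count b (slice z k d) × count b (slice x p n) ≡ count b (slice z k d)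
  image-counts {x} {p} {n} z k d e =
    trans (sym (length-slice x p n)) (trans (cong length e) (trans (length-F (slice z k d)) (cong (_+ count b (slice z k d)) (length-slice z k d)))) ,
    trans (cong (count b) e) (count-b-F _)

  module _ (z : Word) (bz : BalancedIn b z) where

    private
      X : Word
      X = Lω z

    -- a ∷ (window at j) and the window at i without its last letter are images of factors v and u of z.
    -- Comparing lengths and b-counts gives |v| ≤ |u|, and balance of z then bounds |v|_b by |u|_b + 1.
    ¬Lω-unbalanced-tight : ∀ n i j → X j ≡ b → X i ≡ a → X (j + n) ≡ b → X (i + n) ≡ a →
                             2 + count b (slice X i (suc n)) ≤ count b (slice X j (suc n)) → ⊥
    ¬Lω-unbalanced-tight n i j xj xi xjn xin h
      with k , refl ← b⇒suc-pos z j xj | l , refl ← a⇒pos z i xi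
      with dv , V-image ← a-delimited z k (2 + n) (trans (cong X (trans (+-suc (pos z k) (suc n)) (cong suc (+-suc (pos z k) n))))
                                                         (b-followed-by-a z _ xjn))
         | du , U-image ← a-delimited z l n xin =
      1+n≰n (begin
        suc (suc (suc Cu))             ≤⟨ s≤s (subst₂ (λ p q → 2 + p ≤ q) countU countV h) ⟩
        suc Cv                         ≤⟨ s≤s (bz l k dv) ⟩
        suc (suc (count b (slice z l dv))) ≤⟨ s≤s (s≤s (count-slice-mono b z l dv≤du)) ⟩
        suc (suc Cu)                   ∎)
      where
      open ≤-Reasoning
      Cv : ℕ
      Cv = count b (slice z k dv)
      Cu : ℕ
      Cu = count b (slice z l du)
      lengthV : 2 + n ≡ dv + Cv
      lengthV = proj₁ (image-counts {X} z k dv V-image)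
      lengthU : n ≡ du + Cu
      lengthU = proj₁ (image-counts {X} z l du U-image)
      countV : count b (slice X (suc (pos z k)) (suc n)) ≡ Cv
      countV = begin-equality
        count b (slice X (suc (pos z k)) (suc n))                   ≡⟨ count-other a _ ⟨
        count b (a ∷ slice X (suc (pos z k)) (suc n))               ≡⟨ cong (λ c → count b (c ∷ slice X (suc (pos z k)) (suc n))) (Lω-pos z k) ⟨
        count b (X (pos z k) ∷ slice X (suc (pos z k)) (suc n))     ≡⟨ cong (count b) (slice-suc X (pos z k) (suc n)) ⟨
        count b (slice X (pos z k) (2 + n))                          ≡⟨ proj₂ (image-counts {X} z k dv V-image) ⟩
        Cv                                                          ∎
      countU : count b (slice X (pos z l) (suc n)) ≡ Cu
      countU = begin-equality
        count b (slice X (pos z l) (suc n))               ≡⟨ cong (count b) (slice-∷ʳ X (pos z l) n) ⟩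
        count b (slice X (pos z l) n ∷ʳ X (pos z l + n))  ≡⟨ count-∷ʳ b _ _ ⟩
        count b (X (pos z l + n) ∷ slice X (pos z l) n)   ≡⟨ cong (λ c → count b (c ∷ slice X (pos z l) n)) xin ⟩
        count b (a ∷ slice X (pos z l) n)                 ≡⟨ count-other a _ ⟩
        count b (slice X (pos z l) n)                     ≡⟨ proj₂ (image-counts {X} z l du U-image) ⟩
        Cu                                                ∎
      dv≤du : dv ≤ du
      dv≤du = +-cancelʳ-≤ Cv dv du (begin
        dv + Cv           ≡⟨ lengthV ⟨
        2 + n             ≡⟨ cong (2 +_) lengthU ⟩
        2 + (du + Cu)     ≡⟨ +-comm 2 (du + Cu) ⟩
        du + Cu + 2       ≡⟨ +-assoc du Cu 2 ⟩
        du + (Cu + 2)     ≤⟨ +-monoʳ-≤ du (≤-trans (≤-reflexive (+-comm Cu 2)) (subst₂ (λ p q → 2 + p ≤ q) countU countV h)) ⟩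
        du + Cv           ∎)

    ¬Lω-unbalanced : ∀ n i j → 2 + count b (slice X i n) ≤ count b (slice X j n) → ⊥
    ¬Lω-unbalanced zero    i j h = 1+n≰n (≤-trans (n≤1+n _) h)
    ¬Lω-unbalanced (suc n) i j h with X j in xj | letter a (X j)
    ... | _ | is-a = ¬Lω-unbalanced n (suc i) (suc j) (count-drop-first b X i j n (inj₁ (trans xj a≡not-b)) h)
    ... | _ | is-b with X i in xi | letter a (X i)
    ...   | _ | is-b = ¬Lω-unbalanced n (suc i) (suc j) (count-drop-first b X i j n (inj₂ xi) h)
    ...   | _ | is-a with X (j + n) in xjn | letter a (X (j + n))
    ...     | _ | is-a = ¬Lω-unbalanced n i j (count-drop-last b X i j n (inj₁ (trans xjn a≡not-b)) h)
    ...     | _ | is-b with X (i + n) in xin | letter a (X (i + n))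
    ...       | _ | is-b = ¬Lω-unbalanced n i j (count-drop-last b X i j n (inj₂ xin) h)
    ...       | _ | is-a = ¬Lω-unbalanced-tight n i j xj xi xjn xin h

    Lω-balancedIn : BalancedIn b X
    Lω-balancedIn i j n with count b (slice X j n) ≤? suc (count b (slice X i n))
    ... | yes le = le
    ... | no  gt = ⊥-elim (¬Lω-unbalanced n i j (≰⇒> gt))

  Lω-periodic⇒periodic : ∀ z → UltimatelyPeriodic (Lω z) → UltimatelyPeriodic z
  Lω-periodic⇒periodic z (p , p>0 , N , per) = Q , 0<Q , N , z-periodic
    where
    X : Word
    X = Lω z
    Q : ℕ
    Q = count a (slice X N p)

    N≤pos : ∀ {k} → N ≤ k → N ≤ pos z k
    N≤pos N≤k = ≤-trans N≤k (≤-pos z _)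

    pos-periodic : ∀ k → N ≤ k → pos z (k + Q) ≡ pos z k + p
    pos-periodic k N≤k with d , image ← a-delimited z k p (trans (per (pos z k) (N≤pos N≤k)) (Lω-pos z k)) = begin
      pos z (k + Q)                       ≡⟨ cong (λ e → pos z (k + e)) d≡Q ⟨
      pos z (k + d)                       ≡⟨ pos-+ z k d ⟩
      pos z k + length (F (slice z k d))  ≡⟨ cong (λ w → pos z k + length w) image ⟨
      pos z k + length (slice X (pos z k) p) ≡⟨ cong (pos z k +_) (length-slice X (pos z k) p) ⟩
      pos z k + p                         ∎
      where
      open ≡-Reasoning
      d≡Q : d ≡ Q
      d≡Q = begin
        d                                ≡⟨ length-slice z k d ⟨
        length (slice z k d)             ≡⟨ count-a-F (slice z k d) ⟨
        count a (F (slice z k d))        ≡⟨ cong (count a) image ⟨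
        count a (slice X (pos z k) p)    ≡⟨ periodic-count a X per (N≤pos N≤k) ⟩
        Q                                ∎

    z-periodic : ∀ n → N ≤ n → z (n + Q) ≡ z n
    z-periodic n N≤n = begin
      z (n + Q)                      ≡⟨ Lω-suc-pos z (n + Q) ⟨
      X (suc (pos z (n + Q)))        ≡⟨ cong (X ∘ suc) (pos-periodic n N≤n) ⟩
      X (suc (pos z n) + p)          ≡⟨ per (suc (pos z n)) (≤-trans (N≤pos N≤n) (n≤1+n _)) ⟩
      X (suc (pos z n))              ≡⟨ Lω-suc-pos z n ⟩
      z n                            ∎
      where open ≡-Reasoning

    0<Q : 0 < Q
    0<Q with p′ , refl ← m≤n⇒∃[o]m+o≡n p>0 = begin
      1                                              ≤⟨ s≤s z≤n ⟩
      suc (count a (slice X (suc (pos z N)) p′))      ≡⟨ count-self a _ ⟨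
      count a (a ∷ slice X (suc (pos z N)) p′)        ≡⟨ cong (λ c → count a (c ∷ slice X (suc (pos z N)) p′)) (Lω-pos z N) ⟨
      count a (X (pos z N) ∷ slice X (suc (pos z N)) p′) ≡⟨ cong (count a) (slice-suc X (pos z N) p′) ⟨
      count a (slice X (pos z N) (suc p′))            ≡⟨ periodic-count a X per (N≤pos ≤-refl) ⟩
      Q                                              ∎
      where open ≤-Reasoning

  Lω-sturmian : ∀ z → Sturmian z → Sturmian (Lω z)
  Lω-sturmian z (az , bz) = az ∘ Lω-periodic⇒periodic z , balancedIn⇒balanced {Lω z} b (Lω-balancedIn z (balanced⇒balancedIn {z} bz b))

  Lω-leftSpecial : ∀ {S} n → LeftSpecial (prefix n S) S → LeftSpecial (prefix n (Lω S)) (Lω S)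
  Lω-leftSpecial {S} n ls = extend-left false , extend-left true
    where
    X : Word
    X = Lω S
    P : List Bool
    P = prefix n S
    extend-left : ∀ c → Factor (c ∷ prefix n X) X
    extend-left c with w , m-c ← m-∷ʳ c | e , n+e≡pos ← m≤n⇒∃[o]m+o≡n (≤-pos S n) =
      proj₁ (factor-++ {X} (c ∷ prefix n X) (slice X n e) (subst (λ v → Factor v X) c∷FP≡ (proj₂ (factor-++ {X} w (c ∷ F P) image))))
      where
      image : Factor (w ++ c ∷ F P) X
      image = subst (λ v → Factor v X) (trans (cong (_++ F P) m-c) (∷ʳ-++ w c (F P))) (factor-extend {y = S} (leftSpecial-∷ {x = S} ls c))
      c∷FP≡ : c ∷ F P ≡ (c ∷ prefix n X) ++ slice X n e
      c∷FP≡ = cong (c ∷_) (trans (sym (F-prefix S n)) (trans (cong (λ k → prefix k X) (sym n+e≡pos)) (prefix-+ n e X)))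

  Lω-standard : ∀ {S} → StandardSturmian S → StandardSturmian (Lω S)
  Lω-standard {S} (sS , ls) = Lω-sturmian S sS , λ n → Lω-leftSpecial n (ls n)

  image-occurrence⇒factor : ∀ y l w → slice (Lω y) (pos y l) (length (F w ∷ʳ a)) ≡ F w ∷ʳ a → Factor w y
  image-occurrence⇒factor y l w occ with image , followed ← slice-∷ʳ-split (Lω y) (pos y l) (F w) a occ
    with d , image′ ← a-delimited y l (length (F w)) followed =
    slice≡⇒factor y l (F-injective (slice y l d) w (trans (sym image′) image))

  -- For c ≡ b the letter a just before the occurrence completes the block m b = a ∷ b ∷ [].
  occurrence-of-image : ∀ y P c → Factor (c ∷ (F P ∷ʳ a)) (Lω y) →
                        ∃ λ l → slice (Lω y) (pos y l) (length (F (c ∷ P) ∷ʳ a)) ≡ F (c ∷ P) ∷ʳ a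
  occurrence-of-image y P c (q , occ) with letter a c
  ... | is-a with l , refl ← a⇒pos y q (slice-head (Lω y) q occ) rewrite m-a = l , occ
  ... | is-b with l , refl ← b⇒suc-pos y q (slice-head (Lω y) q occ) rewrite m-b =
    l , trans (slice-suc (Lω y) (pos y l) _) (cong₂ _∷_ (Lω-pos y l) occ)

  Lω-leftSpecial-reflect : ∀ y n → LeftSpecial (prefix (suc (pos y n)) (Lω y)) (Lω y) → LeftSpecial (prefix n y) y
  Lω-leftSpecial-reflect y n ls = reflect false , reflect true
    where
    reflect : ∀ c → Factor (c ∷ prefix n y) y
    reflect c with l , occ ← occurrence-of-image y (prefix n y) c
                               (subst (λ v → Factor (c ∷ v) (Lω y)) (prefix-suc-pos y n) (leftSpecial-∷ {x = Lω y} ls c)) =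
      image-occurrence⇒factor y l (c ∷ prefix n y) occ

  bb-not-factor : ∀ z → Factor (b ∷ b ∷ []) (Lω z) → ⊥
  bb-not-factor z (i , occ) = a≢b (trans (sym (b-followed-by-a z i (slice-head X i occ))) second-b)
    where
    X : Word
    X = Lω z
    second-b : X (suc i) ≡ b
    second-b = slice-head X (suc i) (∷-injectiveʳ (trans (sym (slice-suc X i 1)) occ))

  standard-suffix-starts-with-a : ∀ z {u S} → StandardSturmian S → Lω z ≋ (u ++ω S) → Lω z (length u) ≡ a
  standard-suffix-starts-with-a z {u} {S} (_ , ls) X≋uS = begin
    Lω z (length u)        ≡⟨ cong (Lω z) (+-identityʳ (length u)) ⟨
    Lω z (length u + 0)    ≡⟨ X≋uS (length u + 0) ⟩
    (u ++ω S) (length u + 0) ≡⟨ ++ω-+ u S 0 ⟩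
    S 0                    ≡⟨ S0≡a ⟩
    a                      ∎
    where
    open ≡-Reasoning
    S0≡a : S 0 ≡ a
    S0≡a with S 0 in S0 | letter a (S 0)
    ... | _ | is-a = refl
    ... | _ | is-b = ⊥-elim (bb-not-factor z (factor-shift {x = Lω z} (length u) (factor-cong (≋-++ω⇒shift {Lω z} {u} {S} X≋uS)
                       (subst (λ c → Factor (b ∷ c ∷ []) S) S0 (leftSpecial-∷ {x = S} (ls 1) b)))))

  Lω-singular⇒singular : ∀ z → Sturmian z → Singular (Lω z) → Singular z
  Lω-singular⇒singular z sz (u , S , 1≤u , stS , X≋uS)
    with k , u≡pos ← a⇒pos z (length u) (standard-suffix-starts-with-a z {u} stS X≋uS) =
    prefix k z , shift k z , subst (1 ≤_) (sym (length-prefix k z)) (positive k u≡pos) ,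
    (sturmian-shift k sz , λ n → Lω-leftSpecial-reflect (shift k z) n (proj₂ (standard-cong S≋image stS) (suc (pos (shift k z) n)))) ,
    prefix-++ω-shift k z
    where
    positive : ∀ k → length u ≡ pos z k → 1 ≤ k
    positive zero    e = ⊥-elim (1+n≰n (subst (1 ≤_) e 1≤u))
    positive (suc k) _ = s≤s z≤n
    X≋image : Lω z ≋ (F (prefix k z) ++ω Lω (shift k z))
    X≋image = ≋-trans (extend-cong F (prefix-++ω-shift k z)) (extend-++ω (prefix k z) (shift k z))
    S≋image : S ≋ Lω (shift k z)
    S≋image n = begin
      S n                   ≡⟨ ≋-++ω⇒shift {Lω z} {u} {S} X≋uS n ⟩
      Lω z (length u + n)   ≡⟨ cong (λ p → Lω z (p + n)) u≡pos ⟩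
      Lω z (pos z k + n)    ≡⟨ ≋-++ω⇒shift {Lω z} {F (prefix k z)} X≋image n ⟨
      Lω (shift k z) n      ∎
      where open ≡-Reasoning

  Lω-growth : ∀ {z u S} → Sturmian z → StandardSturmian S → z ≋ (u ++ω S) → 2 ≤ length u →
              length u < length (F u) × Lω z ≋ (F u ++ω Lω S)
  Lω-growth {z} {u} {S} sz stS z≋uS 2≤u = |u|<|Fu| , ≋-trans (extend-cong F z≋uS) (extend-++ω u S)
    where
    |u|<|Fu| : length u < length (F u)
    |u|<|Fu| = begin
      suc (length u)        ≡⟨ +-comm 1 (length u) ⟩
      length u + 1          ≤⟨ +-monoʳ-≤ (length u) (long-prefix-contains b sz stS z≋uS 2≤u) ⟩
      length u + count b u  ≡⟨ length-F u ⟨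
      length (F u)          ∎
      where open ≤-Reasoning

  Lω-transfer : ∀ {P} z → Sturmian z → Transfer P z (Lω z)
  Lω-transfer z sz = record
    { sturmian         = Lω-sturmian z sz
    ; singular-reflect = Lω-singular⇒singular z sz
    ; singular-growth  = λ u S 2≤u stS z≋uS → let |u|<|Fu| , X≋ = Lω-growth {z} {u} {S} sz stS z≋uS 2≤u in
                           F u , Lω S , Lω-standard stS , <⇒≤ |u|<|Fu| , X≋ , λ _ → |u|<|Fu|
    }

module RightMorphism (a : Bool) (m : Bool → List Bool) (m-a : m a ≡ a ∷ []) (m-b : m (not a) ≡ a ∷ not a ∷ [])
                 (r : Bool → List Bool) (r-a : r a ≡ a ∷ []) (r-b : r (not a) ≡ not a ∷ a ∷ []) where
  open LeftMorphism a m m-a m-b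

  Rω : Word → Word
  Rω = extend (concatMap r)

  conjugate : ∀ w → a ∷ concatMap r w ≡ F w ∷ʳ a
  conjugate []      = refl
  conjugate (c ∷ w) with letter a c
  ... | is-a rewrite r-a | m-a = cong (a ∷_) (conjugate w)
  ... | is-b rewrite r-b | m-b = cong (λ t → a ∷ b ∷ t) (conjugate w)

  Rω≋shift : ∀ z → Rω z ≋ shift 1 (Lω z)
  Rω≋shift z n = begin
    at (a ∷ concatMap r (prefix (suc n) z)) (suc n)      ≡⟨ cong (λ w → at w (suc n)) (conjugate (prefix (suc n) z)) ⟩
    at (F (prefix (suc n) z) ∷ʳ a) (suc n)               ≡⟨ cong (λ w → at w (suc n)) (prefix-suc-pos z (suc n)) ⟨
    at (prefix (suc (pos z (suc n))) (Lω z)) (suc n)      ≡⟨ at-prefix (Lω z) (s≤s (≤-pos z (suc n))) ⟩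
    Lω z (suc n)                                          ∎
    where open ≡-Reasoning

  drop-first-letter : ∀ z (u v : List Bool) S → length u < length v → Lω z ≋ (v ++ω S) →
                      ∃ λ u₂ → (length u ≤ length u₂) × (Rω z ≋ (u₂ ++ω S))
  drop-first-letter z u (c ∷ v) S (s≤s u≤v) X≋ = v , u≤v , λ n → trans (Rω≋shift z n) (X≋ (suc n))

  Rω-transfer : ∀ z → Sturmian z → Transfer ⊥ z (Rω z)
  Rω-transfer z sz = record
    { sturmian         = sturmian-cong (≋-sym {Rω z} (Rω≋shift z)) (sturmian-shift 1 (Lω-sturmian z sz))
    ; singular-reflect = reflect
    ; singular-growth  = growth
    }
    where
    reflect : Singular (Rω z) → Singular z
    reflect (u , S , _ , stS , Rz≋uS) = Lω-singular⇒singular z sz (a ∷ u , S , s≤s z≤n , stS , X≋)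
      where
      X≋ : Lω z ≋ ((a ∷ u) ++ω S)
      X≋ zero    = Lω-pos z 0
      X≋ (suc n) = trans (sym (Rω≋shift z n)) (Rz≋uS n)
    growth : SingularGrowth ⊥ z (Rω z)
    growth u S 2≤u stS z≋uS with |u|<|Fu| , X≋ ← Lω-growth {z} {u} {S} sz stS z≋uS 2≤u
      with u₂ , u≤u₂ , Rz≋ ← drop-first-letter z u (F u) (Lω S) |u|<|Fu| X≋ =
      u₂ , Lω S , Lω-standard stS , u≤u₂ , Rz≋ , ⊥-elim

img-nonempty : ∀ g c → 1 ≤ length (img g c)
img-nonempty L0 false = s≤s z≤n
img-nonempty L0 true  = s≤s z≤n
img-nonempty L1 false = s≤s z≤n
img-nonempty L1 true  = s≤s z≤n
img-nonempty R0 false = s≤s z≤n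
img-nonempty R0 true  = s≤s z≤n
img-nonempty R1 false = s≤s z≤n
img-nonempty R1 true  = s≤s z≤n

applyGen-isNonErasingMorphism : ∀ g → IsNonErasingMorphism (applyGen g)
applyGen-isNonErasingMorphism g = concatMap-isNonErasingMorphism (img g) (img-nonempty g)

applyFin-isNonErasingMorphism : ∀ gs → IsNonErasingMorphism (applyFin gs)
applyFin-isNonErasingMorphism []       = record { homo = λ _ _ → refl ; length-≤ = λ _ → ≤-refl }
applyFin-isNonErasingMorphism (g ∷ gs) = ∘-isNonErasingMorphism (applyFin-isNonErasingMorphism gs) (applyGen-isNonErasingMorphism g)

applyGen-transfer : ∀ g z → Sturmian z → Transfer (IsL g) z (extend (applyGen g) z)
applyGen-transfer L0 = LeftMorphism.Lω-transfer false (img L0) refl refl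
applyGen-transfer L1 = LeftMorphism.Lω-transfer true  (img L1) refl refl
applyGen-transfer R0 = RightMorphism.Rω-transfer false (img L0) refl refl (img R0) refl refl
applyGen-transfer R1 = RightMorphism.Rω-transfer true  (img L1) refl refl (img R1) refl refl

applyω-transfer : ∀ gs y → Sturmian y → Transfer (Any IsL gs) y (applyω gs y)
applyω-transfer []       y sy = transfer-cong (λ n → sym (at-prefix y ≤-refl)) (transfer-refl (λ ()) sy)
applyω-transfer (g ∷ gs) y sy =
  transfer-cong (≋-sym {applyω (g ∷ gs) y} (extend-∘ (applyFin-isNonErasingMorphism gs) (applyGen-isNonErasingMorphism g) y))
    (transfer-weaken toSum (transfer-∘ previous (applyGen-transfer g (applyω gs y) (sturmian previous))))
  where
  previous : Transfer (Any IsL gs) y (applyω gs y)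
  previous = applyω-transfer gs y sy

mainTheorem19 : (y : Word) (f : List⁺ Gen) → Sturmian y →
    (Singular (applyω (toList f) y) → Singular y) ×
    ((u′ : List Bool) (S′ : Word) → 2 ≤ length u′ → StandardSturmian S′ → y ≋ (u′ ++ω S′) →
      ∃ λ (u : List Bool) → ∃ λ (S : Word) →
        StandardSturmian S × (1 ≤ length u) × (length u′ ≤ length u) ×
        (applyω (toList f) y ≋ (u ++ω S)) ×
        (Any IsL (toList f) → length u′ < length u))
mainTheorem19 y f sy = singular-reflect t , λ u′ S′ 2≤u′ stS′ y≋ →
  let u , S , stS , u′≤u , x≋ , strict = singular-growth t u′ S′ 2≤u′ stS′ y≋ in
  u , S , stS , ≤-trans (≤-trans (n≤1+n 1) 2≤u′) u′≤u , u′≤u , x≋ , strict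
  where
  t : Transfer (Any IsL (toList f)) y (applyω (toList f) y)
  t = applyω-transfer (toList f) y sy
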